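{- Let $n \geq 1$ and $u, v \in \mathsf{Tr}(n)$. Let $s := \min(u_1,v_1)\cdots\min(u_n,v_n)$ and let $t$ be the word obtained from $s$ by replacing by $0$ every letter $s_j = 1$ for which there exists $i<j$ with $s_i = 0$. Then $t$ is the meet of $u$ and $v$ in $(\mathsf{Tr}(n),\preccurlyeq)$.
   Context: For $n\ge1$, $\mathsf{Tr}(n)$ is the set of words $u = u_1\cdots u_n$ over $\{0,1,2\}$ with $u_1 \neq 2$ and no indices $i<j$ with $u_i=0$, $u_j=1$, ordered componentwise ($u\preccurlyeq v$ iff $u_i\le v_i$ for all $i$). -}

module Defs where

open import Data.Nat using (ℕ; suc; _<_)
open import Data.Fin using (Fin; zero; suc; _≤_)
open import Data.Fin.Properties using () renaming (_≤?_ to _≤F?_)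
open import Data.Vec using (Vec; []; _∷_; lookup; zipWith)
open import Data.Bool using (Bool; true; false)
open import Data.Product using (_×_; ∃)
open import Relation.Binary.PropositionalEquality using (_≡_; _≢_)
open import Relation.Nullary using (¬_; yes; no)

Letter : Set
Letter = Fin 3

l0 l1 l2 : Letter
l0 = zero
l1 = suc zero
l2 = suc (suc zero)

Word : ℕ → Set
Word n = Vec Letter n

-- Tr(n): u₁ ≠ 2 and no i < j with u_i = 0, u_j = 1.
-- (n ≥ 1 is enforced by using Word (suc n).)
InTr : ∀ {n} → Word (suc n) → Set
InTr {n} u = (lookup u zero ≢ l2) ×
  (∀ (i j : Fin (suc n)) → Data.Fin._<_ i j → lookup u i ≡ l0 → lookup u j ≢ l1)

_≼_ : ∀ {n} → Word n → Word n → Set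
u ≼ v = ∀ i → lookup u i ≤ lookup v i

minL : Letter → Letter → Letter
minL a b with a ≤F? b
... | yes _ = a
... | no _ = b

minWord : ∀ {n} → Word n → Word n → Word n
minWord = zipWith minL

-- t: replace by 0 every letter 1 that is preceded (somewhere earlier) by a 0.
-- The flag records whether a 0 has occurred at an earlier position.
zeroOut : ∀ {n} → Bool → Word n → Word n
zeroOut b [] = []
zeroOut false (zero ∷ w) = zero ∷ zeroOut true w
zeroOut false (suc a ∷ w) = suc a ∷ zeroOut false w
zeroOut true (zero ∷ w) = zero ∷ zeroOut true w
zeroOut true (suc zero ∷ w) = zero ∷ zeroOut true w
zeroOut true (suc (suc a) ∷ w) = suc (suc a) ∷ zeroOut true w

tWord : ∀ {n} → Word n → Word n
tWord = zeroOut false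

IsMeetTr : ∀ {n} → Word (suc n) → Word (suc n) → Word (suc n) → Set
IsMeetTr {n} u v m = InTr m × (m ≼ u) × (m ≼ v) ×
  (∀ (w : Word (suc n)) → InTr w → w ≼ u → w ≼ v → w ≼ m)

module Submission where

-- 1. The letterwise minimum s = minWord u v is the meet of u and v among
--    ALL words in the componentwise order; this is pure lattice bookkeeping
--    on the chain 0 < 1 < 2.
-- 2. The correction t = zeroOut false s is the largest word below s that has
--    no pattern "0 before 1": it lies below s, it avoids the pattern, and any
--    pattern-avoiding w ≼ s satisfies w ≼ t.  The flag of zeroOut records
--    whether a 0 has been seen; under the flag true no letter 1 survives.
--
-- The theorem then follows: t ≼ s ≼ u, v; its first letter lies below u₁ ≠ 2,
-- so t ∈ Tr(n); and every lower bound w ∈ Tr(n) of u and v lies below s,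
-- hence below t.  Note that only u₁ ≠ 2 is used about u and v.

open import Defs
open import Data.Nat using (ℕ; suc; z≤n; s≤s)
import Data.Nat.Properties as ℕ
open import Data.Fin using (Fin; zero; suc; _≤_; _<_)
open import Data.Fin.Properties using (≤-refl; ≤-trans) renaming (_≤?_ to _≤F?_)
open import Data.Vec using ([]; _∷_; lookup)
open import Data.Vec.Properties using (lookup-zipWith)
open import Data.Bool using (Bool; true; false)
open import Data.Product using (_,_)
open import Relation.Binary.PropositionalEquality using (_≡_; _≢_; refl; sym; subst)
open import Relation.Nullary using (yes; no)

≤-≢l2 : ∀ {c a : Letter} → c ≤ a → a ≢ l2 → c ≢ l2
≤-≢l2 {a = zero}          ()           _   refl
≤-≢l2 {a = suc zero}      (s≤s ())     _   refl
≤-≢l2 {a = suc (suc zero)} _           a≢2 refl = a≢2 refl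

≤l1-≢l1 : ∀ {c : Letter} → c ≤ l1 → c ≢ l1 → c ≤ l0
≤l1-≢l1 {zero}          _ _ = z≤n
≤l1-≢l1 {suc zero}      _ c≢1 with () ← c≢1 refl
≤l1-≢l1 {suc (suc zero)} (s≤s ()) _

≤l0 : ∀ {c : Letter} → c ≤ l0 → c ≡ l0
≤l0 {zero} _ = refl

minL-≤ˡ : ∀ (a b : Letter) → minL a b ≤ a
minL-≤ˡ a b with a ≤F? b
... | yes _   = ≤-refl
... | no  a≰b = ℕ.≰⇒≥ a≰b

minL-≤ʳ : ∀ (a b : Letter) → minL a b ≤ b
minL-≤ʳ a b with a ≤F? b
... | yes a≤b = a≤b
... | no  _   = ≤-refl

minL-greatest : ∀ {a b c : Letter} → c ≤ a → c ≤ b → c ≤ minL a b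
minL-greatest {a} {b} c≤a c≤b with a ≤F? b
... | yes _ = c≤a
... | no  _ = c≤b

_∷≼_ : ∀ {n} {x y : Letter} {u v : Word n} → x ≤ y → u ≼ v → (x ∷ u) ≼ (y ∷ v)
(x≤y ∷≼ u≼v) zero    = x≤y
(x≤y ∷≼ u≼v) (suc i) = u≼v i

minWord-≼ˡ : ∀ {n} (u v : Word n) → minWord u v ≼ u
minWord-≼ˡ u v i = subst (_≤ lookup u i) (sym (lookup-zipWith minL i u v)) (minL-≤ˡ (lookup u i) (lookup v i))

minWord-≼ʳ : ∀ {n} (u v : Word n) → minWord u v ≼ v
minWord-≼ʳ u v i = subst (_≤ lookup v i) (sym (lookup-zipWith minL i u v)) (minL-≤ʳ (lookup u i) (lookup v i))

minWord-greatest : ∀ {n} (u v w : Word n) → w ≼ u → w ≼ v → w ≼ minWord u v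
minWord-greatest u v w w≼u w≼v i =
  subst (lookup w i ≤_) (sym (lookup-zipWith minL i u v)) (minL-greatest (w≼u i) (w≼v i))

NoOne : ∀ {n} → Word n → Set
NoOne {n} w = ∀ (j : Fin n) → lookup w j ≢ l1

NoZeroOne : ∀ {n} → Word n → Set
NoZeroOne {n} w = ∀ (i j : Fin n) → i < j → lookup w i ≡ l0 → lookup w j ≢ l1

∷-noZeroOne : ∀ {n} {x : Letter} {w : Word n} →
  (x ≡ l0 → NoOne w) → NoZeroOne w → NoZeroOne (x ∷ w)
∷-noZeroOne x≡0⇒noOne _  zero    (suc j) _         x≡0 = x≡0⇒noOne x≡0 j
∷-noZeroOne _         ok (suc i) (suc j) (s≤s i<j) wi≡0 = ok i j i<j wi≡0

head-noZeroOne : ∀ {n} {x : Letter} {w : Word n} → NoZeroOne (x ∷ w) → x ≡ l0 → NoOne w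
head-noZeroOne ok x≡0 j = ok zero (suc j) (s≤s z≤n) x≡0

tail-noZeroOne : ∀ {n} {x : Letter} {w : Word n} → NoZeroOne (x ∷ w) → NoZeroOne w
tail-noZeroOne ok i j i<j = ok (suc i) (suc j) (s≤s i<j)

zeroOut-true-noOne : ∀ {n} (w : Word n) → NoOne (zeroOut true w)
zeroOut-true-noOne (zero          ∷ w) zero    ()
zeroOut-true-noOne (suc zero      ∷ w) zero    ()
zeroOut-true-noOne (suc (suc _)   ∷ w) zero    ()
zeroOut-true-noOne (zero          ∷ w) (suc j) = zeroOut-true-noOne w j
zeroOut-true-noOne (suc zero      ∷ w) (suc j) = zeroOut-true-noOne w j
zeroOut-true-noOne (suc (suc _)   ∷ w) (suc j) = zeroOut-true-noOne w j

-- The output of zeroOut avoids the pattern: every emitted 0 sets the flag.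
zeroOut-noZeroOne : ∀ {n} (b : Bool) (w : Word n) → NoZeroOne (zeroOut b w)
zeroOut-noZeroOne b     []                 ()
zeroOut-noZeroOne false (zero        ∷ w) =
  ∷-noZeroOne (λ _ → zeroOut-true-noOne w) (zeroOut-noZeroOne true w)
zeroOut-noZeroOne false (suc _       ∷ w) = ∷-noZeroOne (λ ()) (zeroOut-noZeroOne false w)
zeroOut-noZeroOne true  (zero        ∷ w) =
  ∷-noZeroOne (λ _ → zeroOut-true-noOne w) (zeroOut-noZeroOne true w)
zeroOut-noZeroOne true  (suc zero    ∷ w) =
  ∷-noZeroOne (λ _ → zeroOut-true-noOne w) (zeroOut-noZeroOne true w)
zeroOut-noZeroOne true  (suc (suc _) ∷ w) = ∷-noZeroOne (λ ()) (zeroOut-noZeroOne true w)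

zeroOut-≼ : ∀ {n} (b : Bool) (w : Word n) → zeroOut b w ≼ w
zeroOut-≼ b     []                 ()
zeroOut-≼ false (zero        ∷ w) = z≤n   ∷≼ zeroOut-≼ true w
zeroOut-≼ false (suc _       ∷ w) = ≤-refl ∷≼ zeroOut-≼ false w
zeroOut-≼ true  (zero        ∷ w) = z≤n   ∷≼ zeroOut-≼ true w
zeroOut-≼ true  (suc zero    ∷ w) = z≤n   ∷≼ zeroOut-≼ true w
zeroOut-≼ true  (suc (suc _) ∷ w) = ≤-refl ∷≼ zeroOut-≼ true w

zeroOut-true-greatest : ∀ {n} (s w : Word n) → NoOne w → w ≼ s → w ≼ zeroOut true s
zeroOut-true-greatest []                 []      _     _   ()
zeroOut-true-greatest (zero        ∷ s) (_ ∷ w) noOne w≼s =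
  w≼s zero ∷≼ zeroOut-true-greatest s w (λ j → noOne (suc j)) (λ i → w≼s (suc i))
zeroOut-true-greatest (suc zero    ∷ s) (_ ∷ w) noOne w≼s =
  ≤l1-≢l1 (w≼s zero) (noOne zero) ∷≼
  zeroOut-true-greatest s w (λ j → noOne (suc j)) (λ i → w≼s (suc i))
zeroOut-true-greatest (suc (suc _) ∷ s) (_ ∷ w) noOne w≼s =
  w≼s zero ∷≼ zeroOut-true-greatest s w (λ j → noOne (suc j)) (λ i → w≼s (suc i))

-- tWord s is the largest pattern-avoiding word below s: a lower bound w
-- must have a 0 wherever s first has a 0, after which w contains no 1.
zeroOut-false-greatest : ∀ {n} (s w : Word n) → NoZeroOne w → w ≼ s → w ≼ zeroOut false s
zeroOut-false-greatest []           []      _  _   ()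
zeroOut-false-greatest (zero  ∷ s) (_ ∷ w) ok w≼s =
  w≼s zero ∷≼ zeroOut-true-greatest s w (head-noZeroOne ok (≤l0 (w≼s zero))) (λ i → w≼s (suc i))
zeroOut-false-greatest (suc _ ∷ s) (_ ∷ w) ok w≼s =
  w≼s zero ∷≼ zeroOut-false-greatest s w (tail-noZeroOne ok) (λ i → w≼s (suc i))

proposition1p5 : ∀ (n : ℕ) (u v : Word (suc n)) → InTr u → InTr v →
    IsMeetTr u v (tWord (minWord u v))
proposition1p5 n u v (u₁≢2 , _) _ =
  (t₁≢2 , zeroOut-noZeroOne false s) , t≼u , t≼v , greatest
  where
  s : Word (suc n)
  s = minWord u v

  t≼u : tWord s ≼ u
  t≼u i = ≤-trans (zeroOut-≼ false s i) (minWord-≼ˡ u v i)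

  t≼v : tWord s ≼ v
  t≼v i = ≤-trans (zeroOut-≼ false s i) (minWord-≼ʳ u v i)

  t₁≢2 : lookup (tWord s) zero ≢ l2
  t₁≢2 = ≤-≢l2 (t≼u zero) u₁≢2

  greatest : ∀ w → InTr w → w ≼ u → w ≼ v → w ≼ tWord s
  greatest w (_ , w-ok) w≼u w≼v = zeroOut-false-greatest s w w-ok (minWord-greatest u v w w≼u w≼v)
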